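{- Let $n$ and $k$ be integers with $n-1>k\ge 2$ and $k$ even, and let $H_{k,n}$ be the Harary graph. Put $D=\lfloor \frac{n+k-2}{k}\rfloor$. Then $\mathrm{diam}(H_{k,n})=D$, every vertex $x$ of $H_{k,n}$ satisfies \[W(x,H_{k,n})=\tfrac{1}{2}D\,(2n+k-2-kD),\] and \[W(H_{k,n})=\tfrac{1}{4}\,n\,D\,(2n+k-2-kD).\]
   Context: For $n>k\ge 2$ with $k$ even, the Harary graph $H_{k,n}$ has vertex set $\{0,1,\dots,n-1\}$ placed in this order around a circle, and each vertex is adjacent to the nearest $k/2$ vertices in each direction around the circle (i.e. $i$ and $j$ are adjacent iff $1\le \min(|i-j|, n-|i-j|)\le k/2$). For a connected graph $G$, $d_G(x,y)$ is the length of a shortest $x$–$y$ path; $\mathrm{diam}(G)$ is the maximum distance between two vertices; the status of a vertex $x$ is $W(x,G)=\sum_{y\in V(G)} d_G(x,y)$; the Wiener index is $W(G)=\sum_{\{x,y\}\subseteq V(G)} d_G(x,y)$, the sum over unordered pairs of distinct vertices. -}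

module Defs where

open import Data.Nat using (ℕ; zero; suc; _+_; _*_; _∸_; _≤_; _<_; ∣_-_∣; _⊓_; _/_)
open import Data.Nat.ListAction using (sum)
open import Data.Fin using (Fin; toℕ)
open import Data.List using (List; map; allFin; filter)
open import Data.Product using (_×_)
open import Relation.Nullary using (¬_)
open import Relation.Binary.PropositionalEquality using (_≡_)
import Data.Fin as F

circDist : (n : ℕ) → Fin n → Fin n → ℕ
circDist n i j = ∣ toℕ i - toℕ j ∣ ⊓ (n ∸ ∣ toℕ i - toℕ j ∣)

HararyAdj : (k n : ℕ) → Fin n → Fin n → Set
HararyAdj k n i j = (1 ≤ circDist n i j) × (circDist n i j ≤ k / 2)

data Walk {V : Set} (E : V → V → Set) : V → V → ℕ → Set where
  stay : ∀ {x} → Walk E x x 0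
  step : ∀ {x y z m} → E x y → Walk E y z m → Walk E x z (suc m)

IsDistance : {V : Set} (E : V → V → Set) → (V → V → ℕ) → Set
IsDistance E δ = ∀ x y → Walk E x y (δ x y) × (∀ m → Walk E x y m → δ x y ≤ m)

IsDiameter : ∀ {n} → (Fin n → Fin n → ℕ) → ℕ → Set
IsDiameter {n} δ D = (∀ x y → δ x y ≤ D) × Data.Product.∃ (λ x → Data.Product.∃ (λ y → δ x y ≡ D))

status : ∀ {n} → (Fin n → Fin n → ℕ) → Fin n → ℕ
status {n} δ x = sum (map (δ x) (allFin n))

wiener : ∀ {n} → (Fin n → Fin n → ℕ) → ℕ
wiener {n} δ = sum (map (λ x → sum (map (δ x) (filter (λ y → x F.<? y) (allFin n)))) (allFin n))

module Submission where

-- With h = k/2, a step of H_{k,n} changes the circular distance c(x, ·) by at most h, and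
-- h positions around the cycle are always covered by one step; hence d(x,y) = ⌈c(x,y)/h⌉.
-- By rotation the circular distances from any vertex are 0, …, ⌊n/2⌋ on one side and
-- 1, …, ⌊(n-1)/2⌋ on the other, so every vertex has status Σ_{t≤⌊n/2⌋} ⌈t/h⌉ + Σ_{t≤⌊(n-1)/2⌋} ⌈t/h⌉.
-- Both ⌊n/2⌋ and ⌊(n-1)/2⌋ lie in [h(D-1), hD], and on that block 2 Σ_{t≤a} ⌈t/h⌉ = D(2a - h(D-1)),
-- which gives the status; the diameter is ⌈⌊n/2⌋/h⌉ = D, and W = n W(x) / 2.

open import Defs
open import Data.Fin using (Fin; toℕ; fromℕ<; zero; suc)
import Data.Fin as F
open import Data.Fin.Properties using (toℕ<n; toℕ-fromℕ<; toℕ-injective)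
open import Data.List using (List; []; _∷_; map; tabulate; allFin; filter)
open import Data.List.Properties using (map-tabulate; map-cong; map-∘; filter-accept; filter-reject)
open import Data.Nat using (ℕ; zero; suc; pred; _+_; _*_; _∸_; _<_; _≤_; _/_; _%_; _⊓_; ∣_-_∣; ⌊_/2⌋; ⌈_/2⌉; z≤n; s≤s; s≤s⁻¹; NonZero; >-nonZero⁻¹)
open import Data.Nat.Divisibility using (_∣_; divides; ∣-refl)
open import Data.Nat.DivMod
open import Data.Nat.ListAction using (sum)
open import Data.Nat.Properties
open import Data.Nat.Tactic.RingSolver using (solve-∀)
open import Data.Product using (Σ; _×_; _,_; proj₁; proj₂)
open import Data.Sum using (_⊎_; inj₁; inj₂)
open import Function using (_∘_; id)
open import Relation.Binary.PropositionalEquality using (_≡_; refl; sym; trans; cong; cong₂; subst; subst₂; module ≡-Reasoning)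
open import Relation.Nullary using (Dec; yes; no; contradiction)

sumBelow : ℕ → (ℕ → ℕ) → ℕ
sumBelow zero    f = 0
sumBelow (suc m) f = f 0 + sumBelow m (f ∘ suc)

syntax sumBelow m (λ t → e) = ∑[ t < m ] e

∑-cong : ∀ m {f g : ℕ → ℕ} → (∀ t → t < m → f t ≡ g t) → ∑[ t < m ] f t ≡ ∑[ t < m ] g t
∑-cong zero    eq = refl
∑-cong (suc m) eq = cong₂ _+_ (eq 0 (s≤s z≤n)) (∑-cong m (λ t t<m → eq (suc t) (s≤s t<m)))

∑-last : ∀ m (f : ℕ → ℕ) → ∑[ t < suc m ] f t ≡ ∑[ t < m ] f t + f m
∑-last zero    f = +-comm (f 0) 0
∑-last (suc m) f = trans (cong (f 0 +_) (∑-last m (f ∘ suc))) (sym (+-assoc (f 0) _ _))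

∑-split : ∀ p q (f : ℕ → ℕ) → ∑[ t < p + q ] f t ≡ ∑[ t < p ] f t + ∑[ t < q ] f (p + t)
∑-split zero    q f = refl
∑-split (suc p) q f = trans (cong (f 0 +_) (∑-split p q (f ∘ suc))) (sym (+-assoc (f 0) _ _))

∑-reverse : ∀ m (f : ℕ → ℕ) → ∑[ t < m ] f t ≡ ∑[ t < m ] f (m ∸ suc t)
∑-reverse zero    f = refl
∑-reverse (suc m) f = begin
  ∑[ t < suc m ] f t                 ≡⟨ ∑-last m f ⟩
  ∑[ t < m ] f t + f m               ≡⟨ +-comm _ (f m) ⟩
  f m + ∑[ t < m ] f t               ≡⟨ cong (f m +_) (∑-reverse m f) ⟩
  f m + ∑[ t < m ] f (m ∸ suc t)     ∎
  where open ≡-Reasoning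

∑-const : ∀ m c → ∑[ t < m ] c ≡ m * c
∑-const zero    c = refl
∑-const (suc m) c = cong (c +_) (∑-const m c)

⌈_/_⌉ : ℕ → (d : ℕ) → .{{NonZero d}} → ℕ
⌈ m / d ⌉ = (m + pred d) / d

module _ {d : ℕ} .{{_ : NonZero d}} where

  ⌈/⌉-monoˡ-≤ : ∀ {m m′} → m ≤ m′ → ⌈ m / d ⌉ ≤ ⌈ m′ / d ⌉
  ⌈/⌉-monoˡ-≤ m≤m′ = /-monoˡ-≤ d (+-monoˡ-≤ (pred d) m≤m′)

  ⌈d+m/d⌉≡1+⌈m/d⌉ : ∀ m → ⌈ d + m / d ⌉ ≡ suc ⌈ m / d ⌉
  ⌈d+m/d⌉≡1+⌈m/d⌉ m = begin
    (d + m + pred d) / d           ≡⟨ /-congˡ (+-assoc d m (pred d)) ⟩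
    (d + (m + pred d)) / d         ≡⟨ +-distrib-/-∣ˡ (m + pred d) (∣-refl {d}) ⟩
    d / d + (m + pred d) / d       ≡⟨ cong (_+ ⌈ m / d ⌉) (n/n≡1 d) ⟩
    suc ⌈ m / d ⌉                  ∎
    where open ≡-Reasoning

  ⌈d*q+m/d⌉≡q+⌈m/d⌉ : ∀ q m → ⌈ d * q + m / d ⌉ ≡ q + ⌈ m / d ⌉
  ⌈d*q+m/d⌉≡q+⌈m/d⌉ zero    m = cong (λ x → ⌈ x + m / d ⌉) (*-zeroʳ d)
  ⌈d*q+m/d⌉≡q+⌈m/d⌉ (suc q) m = begin
    ⌈ d * suc q + m / d ⌉          ≡⟨ cong ⌈_/ d ⌉ (trans (cong (_+ m) (*-suc d q)) (+-assoc d (d * q) m)) ⟩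
    ⌈ d + (d * q + m) / d ⌉        ≡⟨ ⌈d+m/d⌉≡1+⌈m/d⌉ (d * q + m) ⟩
    suc ⌈ d * q + m / d ⌉          ≡⟨ cong suc (⌈d*q+m/d⌉≡q+⌈m/d⌉ q m) ⟩
    suc q + ⌈ m / d ⌉              ∎
    where open ≡-Reasoning

⌈0/d⌉≡0 : ∀ {d} .{{_ : NonZero d}} → ⌈ 0 / d ⌉ ≡ 0
⌈0/d⌉≡0 {suc d′} = m<n⇒m/n≡0 ≤-refl

⌈m/d⌉≡1 : ∀ {d} .{{_ : NonZero d}} {m} → 0 < m → m ≤ d → ⌈ m / d ⌉ ≡ 1
⌈m/d⌉≡1 {suc d′} {m} 0<m m≤d = ≤-antisym
  (begin
    ⌈ m / suc d′ ⌉           ≤⟨ ⌈/⌉-monoˡ-≤ (subst (m ≤_) (sym (+-identityʳ (suc d′))) m≤d) ⟩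
    ⌈ suc d′ + 0 / suc d′ ⌉  ≡⟨ ⌈d+m/d⌉≡1+⌈m/d⌉ 0 ⟩
    suc ⌈ 0 / suc d′ ⌉       ≡⟨ cong suc ⌈0/d⌉≡0 ⟩
    1                        ∎)
  (begin
    1                        ≡⟨ n/n≡1 (suc d′) ⟨
    ⌈ 1 / suc d′ ⌉           ≤⟨ ⌈/⌉-monoˡ-≤ 0<m ⟩
    ⌈ m / suc d′ ⌉           ∎)
  where open ≤-Reasoning

⌈m/d⌉≡1+q : ∀ {d} .{{_ : NonZero d}} {q m} → d * q < m → m ≤ d * q + d → ⌈ m / d ⌉ ≡ suc q
⌈m/d⌉≡1+q {d} {q} {m} lo hi = begin
  ⌈ m / d ⌉                    ≡⟨ cong ⌈_/ d ⌉ (m+[n∸m]≡n (<⇒≤ lo)) ⟨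
  ⌈ d * q + (m ∸ d * q) / d ⌉  ≡⟨ ⌈d*q+m/d⌉≡q+⌈m/d⌉ q (m ∸ d * q) ⟩
  q + ⌈ m ∸ d * q / d ⌉        ≡⟨ cong (q +_) (⌈m/d⌉≡1 (m<n⇒0<n∸m lo) (m≤n+o⇒m∸n≤o m (d * q) hi)) ⟩
  q + 1                        ≡⟨ +-comm q 1 ⟩
  suc q                        ∎
  where open ≡-Reasoning

circDistℕ : ℕ → ℕ → ℕ → ℕ
circDistℕ n a b = ∣ a - b ∣ ⊓ (n ∸ ∣ a - b ∣)

circDistℕ-comm : ∀ n a b → circDistℕ n a b ≡ circDistℕ n b a
circDistℕ-comm n a b = cong (λ x → x ⊓ (n ∸ x)) (∣-∣-comm a b)

circDistℕ-self : ∀ n a → circDistℕ n a a ≡ 0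
circDistℕ-self n a = cong (λ x → x ⊓ (n ∸ x)) (∣n-n∣≡0 a)

∣m-n∣≤o : ∀ {m n o} → m ≤ o → n ≤ o → ∣ m - n ∣ ≤ o
∣m-n∣≤o {m} {n} m≤o n≤o = ≤-trans (∣m-n∣≤m⊔n m n) (⊔-lub m≤o n≤o)

circDistℕ-half : ∀ {n a b} → a ≤ n → b ≤ n → circDistℕ n a b + circDistℕ n a b ≤ n
circDistℕ-half {n} {a} {b} a≤n b≤n = begin
  circDistℕ n a b + circDistℕ n a b   ≤⟨ +-mono-≤ (m⊓n≤m ∣ a - b ∣ (n ∸ ∣ a - b ∣)) (m⊓n≤n ∣ a - b ∣ (n ∸ ∣ a - b ∣)) ⟩
  ∣ a - b ∣ + (n ∸ ∣ a - b ∣)         ≡⟨ m+[n∸m]≡n (∣m-n∣≤o a≤n b≤n) ⟩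
  n                                   ∎
  where open ≤-Reasoning

∣m-o∣≡∣m-n∣+∣n-o∣ : ∀ {m n o} → m ≤ n → n ≤ o → ∣ m - o ∣ ≡ ∣ m - n ∣ + ∣ n - o ∣
∣m-o∣≡∣m-n∣+∣n-o∣ {m} {n} {o} m≤n n≤o = begin
  ∣ m - o ∣                  ≡⟨ m≤n⇒∣m-n∣≡n∸m (≤-trans m≤n n≤o) ⟩
  o ∸ m                      ≡⟨ cong (_∸ m) (m∸n+n≡m n≤o) ⟨
  o ∸ n + n ∸ m              ≡⟨ +-∸-assoc (o ∸ n) m≤n ⟩
  o ∸ n + (n ∸ m)            ≡⟨ +-comm (o ∸ n) (n ∸ m) ⟩
  n ∸ m + (o ∸ n)            ≡⟨ cong₂ _+_ (m≤n⇒∣m-n∣≡n∸m m≤n) (m≤n⇒∣m-n∣≡n∸m n≤o) ⟨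
  ∣ m - n ∣ + ∣ n - o ∣      ∎
  where open ≡-Reasoning

perimeter-≤ : ∀ {n a b c} → a ≤ n → b ≤ n → c ≤ n → ∣ a - b ∣ + ∣ b - c ∣ + ∣ a - c ∣ ≤ n + n
perimeter-≤ {n} {a} {b} {c} a≤n b≤n c≤n = by-order (≤-total a b) (≤-total b c) (≤-total a c)
  where
    P : ℕ → ℕ → ℕ → ℕ
    P x y z = ∣ x - y ∣ + ∣ y - z ∣ + ∣ x - z ∣

    sorted : ∀ {x y z} → x ≤ y → y ≤ z → z ≤ n → P x y z ≤ n + n
    sorted {x} {y} {z} x≤y y≤z z≤max = subst (_≤ n + n) (cong (_+ ∣ x - z ∣) (∣m-o∣≡∣m-n∣+∣n-o∣ x≤y y≤z))
      (+-mono-≤ ∣x-z∣≤n ∣x-z∣≤n)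
      where ∣x-z∣≤n : ∣ x - z ∣ ≤ n
            ∣x-z∣≤n = ∣m-n∣≤o (≤-trans x≤y (≤-trans y≤z z≤max)) z≤max

    swap₁₂ : ∀ x y z → P x y z ≡ P y x z
    swap₁₂ x y z = trans (cong (λ u → u + ∣ y - z ∣ + ∣ x - z ∣) (∣-∣-comm x y)) (lemma ∣ y - x ∣ ∣ y - z ∣ ∣ x - z ∣)
      where lemma : ∀ u v w → u + v + w ≡ u + w + v
            lemma = solve-∀

    swap₂₃ : ∀ x y z → P x y z ≡ P x z y
    swap₂₃ x y z = trans (cong (λ u → ∣ x - y ∣ + u + ∣ x - z ∣) (∣-∣-comm y z)) (lemma ∣ x - y ∣ ∣ z - y ∣ ∣ x - z ∣)
      where lemma : ∀ u v w → u + v + w ≡ w + v + u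
            lemma = solve-∀

    by-order : a ≤ b ⊎ b ≤ a → b ≤ c ⊎ c ≤ b → a ≤ c ⊎ c ≤ a → P a b c ≤ n + n
    by-order (inj₁ a≤b) (inj₁ b≤c) _          = sorted a≤b b≤c c≤n
    by-order (inj₁ a≤b) (inj₂ c≤b) (inj₁ a≤c) = subst (_≤ n + n) (sym (swap₂₃ a b c)) (sorted a≤c c≤b b≤n)
    by-order (inj₁ a≤b) (inj₂ c≤b) (inj₂ c≤a) = subst (_≤ n + n) (sym (trans (swap₂₃ a b c) (swap₁₂ a c b))) (sorted c≤a a≤b b≤n)
    by-order (inj₂ b≤a) (inj₁ b≤c) (inj₁ a≤c) = subst (_≤ n + n) (sym (swap₁₂ a b c)) (sorted b≤a a≤c c≤n)
    by-order (inj₂ b≤a) (inj₁ b≤c) (inj₂ c≤a) = subst (_≤ n + n) (sym (trans (swap₁₂ a b c) (swap₂₃ b a c))) (sorted b≤c c≤a a≤n)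
    by-order (inj₂ b≤a) (inj₂ c≤b) _          = subst (_≤ n + n) (sym (trans (swap₁₂ a b c) (trans (swap₂₃ b a c) (swap₁₂ b c a)))) (sorted c≤b b≤a a≤n)

m∸n≤m∸o+p : ∀ {m n o p} → o ≤ m → o ≤ n + p → m ∸ n ≤ m ∸ o + p
m∸n≤m∸o+p {m} {n} {o} {p} o≤m o≤n+p = m≤n+o⇒m∸n≤o m n (begin
  m                    ≡⟨ m∸n+n≡m o≤m ⟨
  m ∸ o + o            ≤⟨ +-monoʳ-≤ (m ∸ o) o≤n+p ⟩
  m ∸ o + (n + p)      ≡⟨ lemma (m ∸ o) n p ⟩
  n + (m ∸ o + p)      ∎)
  where
    open ≤-Reasoning
    lemma : ∀ x y z → x + (y + z) ≡ y + (x + z)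
    lemma = solve-∀

≤m∸n+[m∸o] : ∀ {m n o p} → n ≤ m → o ≤ m → n + o + p ≤ m + m → p ≤ m ∸ n + (m ∸ o)
≤m∸n+[m∸o] {m} {n} {o} {p} n≤m o≤m sum≤ = begin
  p                       ≤⟨ m+n≤o⇒m≤o∸n p (subst (_≤ m + m) (+-comm (n + o) p) sum≤) ⟩
  m + m ∸ (n + o)         ≡⟨ ∸-+-assoc (m + m) n o ⟨
  m + m ∸ n ∸ o           ≡⟨ cong (_∸ o) (+-∸-comm m n≤m) ⟩
  m ∸ n + m ∸ o           ≡⟨ +-∸-assoc (m ∸ n) o≤m ⟩
  m ∸ n + (m ∸ o)         ∎
  where open ≤-Reasoning

circDistℕ-triangle : ∀ {n a b c} → a ≤ n → b ≤ n → c ≤ n →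
                     circDistℕ n a c ≤ circDistℕ n a b + circDistℕ n b c
circDistℕ-triangle {n} {a} {b} {c} a≤n b≤n c≤n =
  by-cases (⊓-sel ∣ a - b ∣ (n ∸ ∣ a - b ∣)) (⊓-sel ∣ b - c ∣ (n ∸ ∣ b - c ∣))
  where
    direct : circDistℕ n a c ≤ ∣ a - c ∣
    direct = m⊓n≤m ∣ a - c ∣ (n ∸ ∣ a - c ∣)
    wrapped : circDistℕ n a c ≤ n ∸ ∣ a - c ∣
    wrapped = m⊓n≤n ∣ a - c ∣ (n ∸ ∣ a - c ∣)
    via : ∀ {x y} → circDistℕ n a b ≡ x → circDistℕ n b c ≡ y → circDistℕ n a c ≤ x + y →
          circDistℕ n a c ≤ circDistℕ n a b + circDistℕ n b c
    via eq₁ eq₂ le = ≤-trans le (≤-reflexive (sym (cong₂ _+_ eq₁ eq₂)))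

    by-cases : circDistℕ n a b ≡ ∣ a - b ∣ ⊎ circDistℕ n a b ≡ n ∸ ∣ a - b ∣ →
               circDistℕ n b c ≡ ∣ b - c ∣ ⊎ circDistℕ n b c ≡ n ∸ ∣ b - c ∣ →
               circDistℕ n a c ≤ circDistℕ n a b + circDistℕ n b c
    by-cases (inj₁ eq₁) (inj₁ eq₂) = via eq₁ eq₂ (≤-trans direct (∣-∣-triangle a b c))
    by-cases (inj₁ eq₁) (inj₂ eq₂) = via eq₁ eq₂ (≤-trans wrapped (subst (n ∸ ∣ a - c ∣ ≤_) (+-comm (n ∸ ∣ b - c ∣) ∣ a - b ∣)
      (m∸n≤m∸o+p (∣m-n∣≤o b≤n c≤n) (subst (∣ b - c ∣ ≤_) (trans (cong (_+ ∣ a - c ∣) (∣-∣-comm b a)) (+-comm ∣ a - b ∣ ∣ a - c ∣)) (∣-∣-triangle b a c)))))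
    by-cases (inj₂ eq₁) (inj₁ eq₂) = via eq₁ eq₂ (≤-trans wrapped
      (m∸n≤m∸o+p (∣m-n∣≤o a≤n b≤n) (subst (∣ a - b ∣ ≤_) (cong (∣ a - c ∣ +_) (∣-∣-comm c b)) (∣-∣-triangle a c b))))
    by-cases (inj₂ eq₁) (inj₂ eq₂) = via eq₁ eq₂ (≤-trans direct
      (≤m∸n+[m∸o] (∣m-n∣≤o a≤n b≤n) (∣m-n∣≤o b≤n c≤n) (perimeter-≤ a≤n b≤n c≤n)))

circDistℕ-shift : ∀ {n} .{{_ : NonZero n}} {a e} → a < n → e + e ≤ n → circDistℕ n a ((a + e) % n) ≡ e
circDistℕ-shift {n} {a} {e} a<n e+e≤n with a + e <? n
... | yes a+e<n = begin
  circDistℕ n a ((a + e) % n)    ≡⟨ cong (circDistℕ n a) (m<n⇒m%n≡m a+e<n) ⟩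
  circDistℕ n a (a + e)          ≡⟨ cong (λ x → x ⊓ (n ∸ x)) (∣m-m+n∣≡n a e) ⟩
  e ⊓ (n ∸ e)                    ≡⟨ m≤n⇒m⊓n≡m e≤n∸e ⟩
  e                              ∎
  where open ≡-Reasoning
        e≤n∸e : e ≤ n ∸ e
        e≤n∸e = m+n≤o⇒m≤o∸n e e+e≤n
... | no a+e≮n = begin
  circDistℕ n a ((a + e) % n)    ≡⟨ cong (circDistℕ n a) wrap ⟩
  circDistℕ n a (a ∸ u)          ≡⟨ cong (λ x → x ⊓ (n ∸ x)) ∣a-[a∸u]∣≡u ⟩
  u ⊓ (n ∸ u)                    ≡⟨ cong (u ⊓_) (m∸[m∸n]≡n e≤n) ⟩
  u ⊓ e                          ≡⟨ m≥n⇒m⊓n≡n (m+n≤o⇒m≤o∸n e e+e≤n) ⟩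
  e                              ∎
  where
    open ≡-Reasoning
    u : ℕ
    u = n ∸ e
    e≤n : e ≤ n
    e≤n = m+n≤o⇒m≤o e e+e≤n
    u≤a : u ≤ a
    u≤a = m≤n+o⇒m∸n≤o n e (subst (n ≤_) (+-comm a e) (≮⇒≥ a+e≮n))
    ∣a-[a∸u]∣≡u : ∣ a - a ∸ u ∣ ≡ u
    ∣a-[a∸u]∣≡u = trans (∣-∣-comm a (a ∸ u)) (trans (m≤n⇒∣m-n∣≡n∸m (m∸n≤m a u)) (m∸[m∸n]≡n u≤a))
    wrap : (a + e) % n ≡ a ∸ u
    wrap = begin
      (a + e) % n          ≡⟨ cong (_% n) (cong (_+ e) (m∸n+n≡m u≤a)) ⟨
      (a ∸ u + u + e) % n  ≡⟨ cong (_% n) (+-assoc (a ∸ u) u e) ⟩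
      (a ∸ u + (u + e)) % n ≡⟨ cong (λ x → (a ∸ u + x) % n) (m∸n+n≡m e≤n) ⟩
      (a ∸ u + n) % n      ≡⟨ [m+n]%n≡m%n (a ∸ u) n ⟩
      (a ∸ u) % n          ≡⟨ m<n⇒m%n≡m (≤-<-trans (m∸n≤m a u) a<n) ⟩
      a ∸ u                ∎

circDistℕ-rotate : ∀ {n i} → i ≤ n → circDistℕ (suc n) (suc i) 0 ≡ circDistℕ (suc n) i n
circDistℕ-rotate {n} {i} i≤n = begin
  suc i ⊓ (n ∸ i)                   ≡⟨ ⊓-comm (suc i) (n ∸ i) ⟩
  (n ∸ i) ⊓ suc i                   ≡⟨ cong ((n ∸ i) ⊓_) (m∸[m∸n]≡n (s≤s i≤n)) ⟨
  (n ∸ i) ⊓ (suc n ∸ (n ∸ i))       ≡⟨ cong (λ x → x ⊓ (suc n ∸ x)) (m≤n⇒∣m-n∣≡n∸m i≤n) ⟨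
  circDistℕ (suc n) i n             ∎
  where open ≡-Reasoning

-- Moving the centre from i to i + 1 shifts the summands cyclically by one place.
∑-circDistℕ-centre-invariant : ∀ n (f : ℕ → ℕ) {i} → i < n →
                               ∑[ b < n ] f (circDistℕ n i b) ≡ ∑[ b < n ] f (circDistℕ n 0 b)
∑-circDistℕ-centre-invariant (suc n) f {zero}  _           = refl
∑-circDistℕ-centre-invariant (suc n) f {suc i} (s≤s i<n) = begin
  f (circDistℕ (suc n) (suc i) 0) + ∑[ b < n ] f (circDistℕ (suc n) i b)
    ≡⟨ cong (λ x → f x + ∑[ b < n ] f (circDistℕ (suc n) i b)) (circDistℕ-rotate (<⇒≤ i<n)) ⟩
  f (circDistℕ (suc n) i n) + ∑[ b < n ] f (circDistℕ (suc n) i b)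
    ≡⟨ +-comm (f (circDistℕ (suc n) i n)) _ ⟩
  ∑[ b < n ] f (circDistℕ (suc n) i b) + f (circDistℕ (suc n) i n)
    ≡⟨ ∑-last n (f ∘ circDistℕ (suc n) i) ⟨
  ∑[ b < suc n ] f (circDistℕ (suc n) i b)
    ≡⟨ ∑-circDistℕ-centre-invariant (suc n) f (<⇒≤ (s≤s i<n)) ⟩
  ∑[ b < suc n ] f (circDistℕ (suc n) 0 b)
    ∎
  where open ≡-Reasoning

∑-circDistℕ-halves : ∀ (f : ℕ → ℕ) → f 0 ≡ 0 → ∀ {a b} → b ≤ a → a ≤ suc b →
                     ∑[ t < suc a + b ] f (circDistℕ (suc a + b) 0 t) ≡ ∑[ t < suc a ] f t + ∑[ t < suc b ] f t
∑-circDistℕ-halves f f0≡0 {a} {b} b≤a a≤1+b = begin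
  ∑[ t < suc a + b ] f (circDistℕ n 0 t)
    ≡⟨ ∑-split (suc a) b (f ∘ circDistℕ n 0) ⟩
  ∑[ t < suc a ] f (circDistℕ n 0 t) + ∑[ t < b ] f (circDistℕ n 0 (suc a + t))
    ≡⟨ cong₂ _+_ (∑-cong (suc a) near) (∑-cong b far) ⟩
  ∑[ t < suc a ] f t + ∑[ t < b ] f (suc (b ∸ suc t))
    ≡⟨ cong (∑[ t < suc a ] f t +_) (∑-reverse b (f ∘ suc)) ⟨
  ∑[ t < suc a ] f t + ∑[ t < b ] f (suc t)
    ≡⟨ cong (λ x → ∑[ t < suc a ] f t + (x + ∑[ t < b ] f (suc t))) f0≡0 ⟨
  ∑[ t < suc a ] f t + ∑[ t < suc b ] f t
    ∎
  where
    open ≡-Reasoning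
    n : ℕ
    n = suc a + b
    near : ∀ t → t < suc a → f (circDistℕ n 0 t) ≡ f t
    near t t<1+a = cong f (m≤n⇒m⊓n≡m (m+n≤o⇒m≤o∸n t
      (≤-trans (+-mono-≤ t≤a t≤a) (≤-trans (+-monoʳ-≤ a a≤1+b) (≤-reflexive (+-suc a b))))))
      where t≤a : t ≤ a
            t≤a = s≤s⁻¹ t<1+a
    far : ∀ t → t < b → f (circDistℕ n 0 (suc a + t)) ≡ f (suc (b ∸ suc t))
    far t t<b = cong f (begin
      (suc a + t) ⊓ (n ∸ (suc a + t))   ≡⟨ cong ((suc a + t) ⊓_) ([m+n]∸[m+o]≡n∸o (suc a) b t) ⟩
      (suc a + t) ⊓ (b ∸ t)             ≡⟨ m≥n⇒m⊓n≡n (≤-trans (m∸n≤m b t) (≤-trans b≤a (≤-trans (n≤1+n a) (m≤m+n (suc a) t)))) ⟩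
      b ∸ t                             ≡⟨ +-∸-assoc 1 t<b ⟩
      suc (b ∸ suc t)                   ∎)

2*∑⌈s/h⌉≡[1+q]*[hq+2t] : ∀ {h} .{{_ : NonZero h}} q t → t ≤ h →
         2 * ∑[ s < suc (h * q + t) ] ⌈ s / h ⌉ ≡ suc q * (h * q + 2 * t)
2*∑⌈s/h⌉≡[1+q]*[hq+2t] {h} zero zero _ = begin
  2 * ∑[ s < suc (h * 0 + 0) ] ⌈ s / h ⌉   ≡⟨ cong (λ x → 2 * ∑[ s < suc x ] ⌈ s / h ⌉) (lemma h) ⟩
  2 * (⌈ 0 / h ⌉ + 0)                      ≡⟨ cong (λ x → 2 * (x + 0)) ⌈0/d⌉≡0 ⟩
  0                                        ≡⟨ lemma₂ h ⟨
  1 * (h * 0 + 2 * 0)                      ∎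
  where
    open ≡-Reasoning
    lemma : ∀ h → h * 0 + 0 ≡ 0
    lemma = solve-∀
    lemma₂ : ∀ h → 1 * (h * 0 + 2 * 0) ≡ 0
    lemma₂ = solve-∀
2*∑⌈s/h⌉≡[1+q]*[hq+2t] {h} (suc q) zero _ = begin
  2 * ∑[ s < suc (h * suc q + 0) ] ⌈ s / h ⌉   ≡⟨ cong (λ x → 2 * ∑[ s < suc x ] ⌈ s / h ⌉) (lemma₁ h q) ⟩
  2 * ∑[ s < suc (h * q + h) ] ⌈ s / h ⌉       ≡⟨ 2*∑⌈s/h⌉≡[1+q]*[hq+2t] q h ≤-refl ⟩
  suc q * (h * q + 2 * h)                      ≡⟨ lemma₂ h q ⟩
  suc (suc q) * (h * suc q + 2 * 0)            ∎
  where
    open ≡-Reasoning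
    lemma₁ : ∀ h q → h * suc q + 0 ≡ h * q + h
    lemma₁ = solve-∀
    lemma₂ : ∀ h q → suc q * (h * q + 2 * h) ≡ suc (suc q) * (h * suc q + 2 * 0)
    lemma₂ = solve-∀
2*∑⌈s/h⌉≡[1+q]*[hq+2t] {h} q (suc t) t<h = begin
  2 * ∑[ s < suc (h * q + suc t) ] ⌈ s / h ⌉
    ≡⟨ cong (λ x → 2 * ∑[ s < suc x ] ⌈ s / h ⌉) (+-suc (h * q) t) ⟩
  2 * ∑[ s < suc (suc (h * q + t)) ] ⌈ s / h ⌉
    ≡⟨ cong (2 *_) (∑-last (suc (h * q + t)) ⌈_/ h ⌉) ⟩
  2 * (∑[ s < suc (h * q + t) ] ⌈ s / h ⌉ + ⌈ suc (h * q + t) / h ⌉)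
    ≡⟨ cong (λ x → 2 * (∑[ s < suc (h * q + t) ] ⌈ s / h ⌉ + x)) (⌈m/d⌉≡1+q (s≤s (m≤m+n (h * q) t)) hq+t<hq+h) ⟩
  2 * (∑[ s < suc (h * q + t) ] ⌈ s / h ⌉ + suc q)
    ≡⟨ *-distribˡ-+ 2 (∑[ s < suc (h * q + t) ] ⌈ s / h ⌉) (suc q) ⟩
  2 * ∑[ s < suc (h * q + t) ] ⌈ s / h ⌉ + 2 * suc q
    ≡⟨ cong (_+ 2 * suc q) (2*∑⌈s/h⌉≡[1+q]*[hq+2t] q t (<⇒≤ t<h)) ⟩
  suc q * (h * q + 2 * t) + 2 * suc q
    ≡⟨ lemma h q t ⟩
  suc q * (h * q + 2 * suc t)
    ∎
  where
    open ≡-Reasoning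
    hq+t<hq+h : suc (h * q + t) ≤ h * q + h
    hq+t<hq+h = subst (_≤ h * q + h) (+-suc (h * q) t) (+-monoʳ-≤ (h * q) t<h)
    lemma : ∀ h q t → suc q * (h * q + 2 * t) + 2 * suc q ≡ suc q * (h * q + 2 * suc t)
    lemma = solve-∀

2*∑⌈s/h⌉+[1+q]*hq≡[1+q]*2m : ∀ {h} .{{_ : NonZero h}} {q m} → h * q ≤ m → m ≤ h * q + h →
                           2 * ∑[ s < suc m ] ⌈ s / h ⌉ + suc q * (h * q) ≡ suc q * (2 * m)
2*∑⌈s/h⌉+[1+q]*hq≡[1+q]*2m {h} {q} {m} hq≤m m≤hq+h = begin
  2 * ∑[ s < suc m ] ⌈ s / h ⌉ + suc q * (h * q)
    ≡⟨ cong (λ x → 2 * ∑[ s < suc x ] ⌈ s / h ⌉ + suc q * (h * q)) m≡hq+t ⟩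
  2 * ∑[ s < suc (h * q + t) ] ⌈ s / h ⌉ + suc q * (h * q)
    ≡⟨ cong (_+ suc q * (h * q)) (2*∑⌈s/h⌉≡[1+q]*[hq+2t] q t (m≤n+o⇒m∸n≤o m (h * q) m≤hq+h)) ⟩
  suc q * (h * q + 2 * t) + suc q * (h * q)
    ≡⟨ lemma (suc q) (h * q) t ⟩
  suc q * (2 * (h * q + t))
    ≡⟨ cong (λ x → suc q * (2 * x)) m≡hq+t ⟨
  suc q * (2 * m)
    ∎
  where
    open ≡-Reasoning
    t : ℕ
    t = m ∸ h * q
    m≡hq+t : m ≡ h * q + t
    m≡hq+t = sym (m+[n∸m]≡n hq≤m)
    lemma : ∀ p x t → p * (x + 2 * t) + p * x ≡ p * (2 * (x + t))
    lemma = solve-∀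

⌈n/2⌉≤1+⌊n/2⌋ : ∀ n → ⌈ n /2⌉ ≤ suc ⌊ n /2⌋
⌈n/2⌉≤1+⌊n/2⌋ zero          = z≤n
⌈n/2⌉≤1+⌊n/2⌋ (suc zero)    = s≤s z≤n
⌈n/2⌉≤1+⌊n/2⌋ (suc (suc n)) = s≤s (⌈n/2⌉≤1+⌊n/2⌋ n)

m+m≤n⇒m≤⌊n/2⌋ : ∀ {m n} → m + m ≤ n → m ≤ ⌊ n /2⌋
m+m≤n⇒m≤⌊n/2⌋ {m} m+m≤n = ≤-trans (≤-reflexive (n≡⌊n+n/2⌋ m)) (⌊n/2⌋-mono m+m≤n)

m+m<n⇒m<⌈n/2⌉ : ∀ {m n} → m + m < n → m < ⌈ n /2⌉
m+m<n⇒m<⌈n/2⌉ {m} m+m<n = ≤-trans (s≤s (≤-reflexive (n≡⌊n+n/2⌋ m))) (⌈n/2⌉-mono m+m<n)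

n≤m+m⇒⌈n/2⌉≤m : ∀ {m n} → n ≤ m + m → ⌈ n /2⌉ ≤ m
n≤m+m⇒⌈n/2⌉≤m {m} n≤m+m = ≤-trans (⌈n/2⌉-mono n≤m+m) (≤-reflexive (sym (n≡⌈n+n/2⌉ m)))

1+⌊n/2⌋+⌊pred[n]/2⌋≡n : ∀ n .{{_ : NonZero n}} → suc ⌊ n /2⌋ + ⌊ pred n /2⌋ ≡ n
1+⌊n/2⌋+⌊pred[n]/2⌋≡n (suc m) = cong suc (trans (+-comm ⌈ m /2⌉ ⌊ m /2⌋) (⌊n/2⌋+⌈n/2⌉≡n m))

⌊n/2⌋≤1+⌊pred[n]/2⌋ : ∀ n → ⌊ n /2⌋ ≤ suc ⌊ pred n /2⌋
⌊n/2⌋≤1+⌊pred[n]/2⌋ zero    = z≤n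
⌊n/2⌋≤1+⌊pred[n]/2⌋ (suc m) = ⌈n/2⌉≤1+⌊n/2⌋ m

-- In the theorem m = n - 1 and n + 2h - 2 = r + 2h(q + 1) is the division by k = 2h;
-- then ⌊m/2⌋ and ⌈m/2⌉ both lie in [hq, hq + h].
module _ {h q r m : ℕ} .{{_ : NonZero h}} (r<2h : r < h * 2) (m≡1+r+q*2h : m ≡ suc (r + q * (h * 2))) where

  private
    x : ℕ
    x = h * q

    x+x<m : x + x < m
    x+x<m = subst (x + x <_) (sym m≡1+r+q*2h) (s≤s (≤-trans (m≤n+m (x + x) r) (≤-reflexive (cong (r +_) (lemma h q)))))
      where lemma : ∀ h q → h * q + h * q ≡ q * (h * 2)
            lemma = solve-∀

    m≤[x+h]+[x+h] : m ≤ (x + h) + (x + h)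
    m≤[x+h]+[x+h] = subst (_≤ (x + h) + (x + h)) (sym m≡1+r+q*2h)
      (≤-trans (+-monoˡ-≤ (q * (h * 2)) r<2h) (≤-reflexive (lemma h q)))
      where lemma : ∀ h q → h * 2 + q * (h * 2) ≡ (h * q + h) + (h * q + h)
            lemma = solve-∀

    x<⌈m/2⌉ : x < ⌈ m /2⌉
    x<⌈m/2⌉ = m+m<n⇒m<⌈n/2⌉ x+x<m

    ⌈m/2⌉≤x+h : ⌈ m /2⌉ ≤ x + h
    ⌈m/2⌉≤x+h = n≤m+m⇒⌈n/2⌉≤m m≤[x+h]+[x+h]

    x≤⌊m/2⌋ : x ≤ ⌊ m /2⌋
    x≤⌊m/2⌋ = m+m≤n⇒m≤⌊n/2⌋ (<⇒≤ x+x<m)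

    ⌊m/2⌋≤x+h : ⌊ m /2⌋ ≤ x + h
    ⌊m/2⌋≤x+h = ≤-trans (⌊n/2⌋≤⌈n/2⌉ m) ⌈m/2⌉≤x+h

  ⌈⌈m/2⌉/h⌉≡1+q : ⌈ ⌈ m /2⌉ / h ⌉ ≡ suc q
  ⌈⌈m/2⌉/h⌉≡1+q = ⌈m/d⌉≡1+q x<⌈m/2⌉ ⌈m/2⌉≤x+h

  2*∑⌈s/h⌉-halves≡[1+q]*[1+m+r] : 2 * (∑[ s < suc ⌈ m /2⌉ ] ⌈ s / h ⌉ + ∑[ s < suc ⌊ m /2⌋ ] ⌈ s / h ⌉) ≡ suc q * (suc m + r)
  2*∑⌈s/h⌉-halves≡[1+q]*[1+m+r] = +-cancelʳ-≡ (suc q * x + suc q * x) _ _ (begin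
    2 * (A + B) + (suc q * x + suc q * x)              ≡⟨ lemma₁ A B (suc q * x) ⟩
    (2 * A + suc q * x) + (2 * B + suc q * x)          ≡⟨ cong₂ _+_ (2*∑⌈s/h⌉+[1+q]*hq≡[1+q]*2m (<⇒≤ x<⌈m/2⌉) ⌈m/2⌉≤x+h)
                                                                  (2*∑⌈s/h⌉+[1+q]*hq≡[1+q]*2m x≤⌊m/2⌋ ⌊m/2⌋≤x+h) ⟩
    suc q * (2 * ⌈ m /2⌉) + suc q * (2 * ⌊ m /2⌋)      ≡⟨ lemma₂ (suc q) ⌈ m /2⌉ ⌊ m /2⌋ ⟩
    suc q * (2 * (⌊ m /2⌋ + ⌈ m /2⌉))                  ≡⟨ cong (λ y → suc q * (2 * y)) (⌊n/2⌋+⌈n/2⌉≡n m) ⟩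
    suc q * (2 * m)                                    ≡⟨ cong (λ y → suc q * (2 * y)) m≡1+r+q*2h ⟩
    suc q * (2 * suc (r + q * (h * 2)))                ≡⟨ lemma₃ q r h ⟩
    suc q * (suc (suc (r + q * (h * 2))) + r) + (suc q * x + suc q * x)
                                                       ≡⟨ cong (λ y → suc q * (suc y + r) + (suc q * x + suc q * x)) m≡1+r+q*2h ⟨
    suc q * (suc m + r) + (suc q * x + suc q * x)      ∎)
    where
      open ≡-Reasoning
      A B : ℕ
      A = ∑[ s < suc ⌈ m /2⌉ ] ⌈ s / h ⌉
      B = ∑[ s < suc ⌊ m /2⌋ ] ⌈ s / h ⌉
      lemma₁ : ∀ a b c → 2 * (a + b) + (c + c) ≡ (2 * a + c) + (2 * b + c)
      lemma₁ = solve-∀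
      lemma₂ : ∀ p a b → p * (2 * a) + p * (2 * b) ≡ p * (2 * (b + a))
      lemma₂ = solve-∀
      lemma₃ : ∀ q r h → suc q * (2 * suc (r + q * (h * 2)))
                         ≡ suc q * (suc (suc (r + q * (h * 2))) + r) + (suc q * (h * q) + suc q * (h * q))
      lemma₃ = solve-∀

[m%n+o]%n≡[m+o]%n : ∀ m o n .{{_ : NonZero n}} → (m % n + o) % n ≡ (m + o) % n
[m%n+o]%n≡[m+o]%n m o n = begin
  (m % n + o) % n                ≡⟨ [m+kn]%n≡m%n (m % n + o) (m / n) n ⟨
  (m % n + o + m / n * n) % n    ≡⟨ cong (_% n) (lemma (m % n) o (m / n * n)) ⟩
  (m % n + m / n * n + o) % n    ≡⟨ cong (λ x → (x + o) % n) (m≡m%n+[m/n]*n m n) ⟨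
  (m + o) % n                    ∎
  where
    open ≡-Reasoning
    lemma : ∀ a b c → a + b + c ≡ a + c + b
    lemma = solve-∀

sum-map-allFin : ∀ n (f : ℕ → ℕ) → sum (map (f ∘ toℕ) (allFin n)) ≡ ∑[ t < n ] f t
sum-map-allFin n f = trans (cong sum (map-tabulate {n = n} id (f ∘ toℕ))) (sum-tabulate n f)
  where
    sum-tabulate : ∀ n (f : ℕ → ℕ) → sum (tabulate {n = n} (f ∘ toℕ)) ≡ ∑[ t < n ] f t
    sum-tabulate zero    f = refl
    sum-tabulate (suc n) f = cong (f 0 +_) (sum-tabulate n (f ∘ suc))

allFin-suc : ∀ n → allFin (suc n) ≡ zero ∷ map suc (allFin n)
allFin-suc n = cong (zero ∷_) (sym (map-tabulate {n = n} id suc))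

sum-map-map : ∀ {A B : Set} (g : B → ℕ) (k : A → B) xs → sum (map g (map k xs)) ≡ sum (map (g ∘ k) xs)
sum-map-map g k xs = cong sum (sym (map-∘ xs))

sum-map-allFin-suc : ∀ n (g : Fin (suc n) → ℕ) → sum (map g (allFin (suc n))) ≡ g zero + sum (map (g ∘ suc) (allFin n))
sum-map-allFin-suc n g = trans (cong (sum ∘ map g) (allFin-suc n)) (cong (g zero +_) (sum-map-map g suc (allFin n)))

sum-map-+ : ∀ {A : Set} (g k : A → ℕ) xs → sum (map (λ x → g x + k x) xs) ≡ sum (map g xs) + sum (map k xs)
sum-map-+ g k []       = refl
sum-map-+ g k (x ∷ xs) = trans (cong (g x + k x +_) (sum-map-+ g k xs)) (lemma (g x) (k x) (sum (map g xs)) (sum (map k xs)))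
  where lemma : ∀ a b c d → a + b + (c + d) ≡ a + c + (b + d)
        lemma = solve-∀

filter-0<-suc : ∀ {n} (ys : List (Fin n)) → filter (λ y → zero {n} F.<? y) (map suc ys) ≡ map suc ys
filter-0<-suc []       = refl
filter-0<-suc (y ∷ ys) = cong (suc y ∷_) (filter-0<-suc ys)

filter-suc<-suc : ∀ {n} (x : Fin n) (ys : List (Fin n)) → filter (λ y → suc x F.<? y) (map suc ys) ≡ map suc (filter (λ y → x F.<? y) ys)
filter-suc<-suc x []       = refl
filter-suc<-suc x (y ∷ ys) with x F.<? y
... | yes x<y = trans (filter-accept (λ z → suc x F.<? z) (s≤s x<y))
                  (trans (cong (suc y ∷_) (filter-suc<-suc x ys)) (cong (map suc) (sym (filter-accept (λ z → x F.<? z) x<y))))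
... | no x≮y  = trans (filter-reject (λ z → suc x F.<? z) (x≮y ∘ s≤s⁻¹))
                  (trans (filter-suc<-suc x ys) (cong (map suc) (sym (filter-reject (λ z → x F.<? z) x≮y))))

filter-0<-allFin : ∀ n → filter (λ y → zero {n} F.<? y) (allFin (suc n)) ≡ map suc (allFin n)
filter-0<-allFin n = trans (cong (filter (λ y → zero {n} F.<? y)) (allFin-suc n))
  (trans (filter-reject (λ y → zero {n} F.<? y) {zero} {map suc (allFin n)} (λ ())) (filter-0<-suc (allFin n)))

filter-suc<-allFin : ∀ {n} (x : Fin n) → filter (λ y → suc x F.<? y) (allFin (suc n)) ≡ map suc (filter (λ y → x F.<? y) (allFin n))
filter-suc<-allFin {n} x = trans (cong (filter (λ y → suc x F.<? y)) (allFin-suc n))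
  (trans (filter-reject (λ y → suc x F.<? y) {zero} {map suc (allFin n)} (λ ())) (filter-suc<-suc x (allFin n)))

2*wiener≡∑status : ∀ n (f : Fin n → Fin n → ℕ) → (∀ x y → f x y ≡ f y x) → (∀ x → f x x ≡ 0) →
                   2 * wiener f ≡ sum (map (status f) (allFin n))
2*wiener≡∑status zero    f f-comm f-self = refl
2*wiener≡∑status (suc n) f f-comm f-self = begin
  2 * wiener f                                      ≡⟨ cong (2 *_) wiener-suc ⟩
  2 * (R + wiener f′)                               ≡⟨ *-distribˡ-+ 2 R (wiener f′) ⟩
  2 * R + 2 * wiener f′                             ≡⟨ cong (2 * R +_) (2*wiener≡∑status n f′ (λ x y → f-comm (suc x) (suc y)) (f-self ∘ suc)) ⟩
  2 * R + sum (map (status f′) (allFin n))          ≡⟨ lemma R (sum (map (status f′) (allFin n))) ⟩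
  R + (R + sum (map (status f′) (allFin n)))        ≡⟨ ∑status-suc ⟨
  sum (map (status f) (allFin (suc n)))             ∎
  where
    open ≡-Reasoning
    lemma : ∀ r s → 2 * r + s ≡ r + (r + s)
    lemma = solve-∀
    f′ : Fin n → Fin n → ℕ
    f′ x y = f (suc x) (suc y)
    R : ℕ
    R = sum (map (f zero ∘ suc) (allFin n))
    upperRow-zero : sum (map (f zero) (filter (λ y → zero {n} F.<? y) (allFin (suc n)))) ≡ R
    upperRow-zero = trans (cong (sum ∘ map (f zero)) (filter-0<-allFin n)) (sum-map-map (f zero) suc (allFin n))
    upperRow-suc : ∀ x → sum (map (f (suc x)) (filter (λ y → suc x F.<? y) (allFin (suc n))))
                       ≡ sum (map (f′ x) (filter (λ y → x F.<? y) (allFin n)))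
    upperRow-suc x = trans (cong (sum ∘ map (f (suc x))) (filter-suc<-allFin x))
                           (sum-map-map (f (suc x)) suc (filter (λ y → x F.<? y) (allFin n)))
    wiener-suc : wiener f ≡ R + wiener f′
    wiener-suc = trans (sum-map-allFin-suc n _) (cong₂ _+_ upperRow-zero (cong sum (map-cong upperRow-suc (allFin n))))
    status-suc : ∀ x → status f (suc x) ≡ f (suc x) zero + status f′ x
    status-suc x = sum-map-allFin-suc n (f (suc x))
    ∑status-suc : sum (map (status f) (allFin (suc n))) ≡ R + (R + sum (map (status f′) (allFin n)))
    ∑status-suc = begin
      sum (map (status f) (allFin (suc n)))
        ≡⟨ sum-map-allFin-suc n (status f) ⟩
      status f zero + sum (map (status f ∘ suc) (allFin n))
        ≡⟨ cong₂ _+_ (trans (sum-map-allFin-suc n (f zero)) (cong (_+ R) (f-self zero))) (cong sum (map-cong status-suc (allFin n))) ⟩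
      R + sum (map (λ x → f (suc x) zero + status f′ x) (allFin n))
        ≡⟨ cong (R +_) (sum-map-+ (λ x → f (suc x) zero) (status f′) (allFin n)) ⟩
      R + (sum (map (λ x → f (suc x) zero) (allFin n)) + sum (map (status f′) (allFin n)))
        ≡⟨ cong (λ c → R + (c + sum (map (status f′) (allFin n)))) (cong sum (map-cong (λ x → f-comm (suc x) zero) (allFin n))) ⟩
      R + (R + sum (map (status f′) (allFin n)))
        ∎

module _ {V : Set} {E : V → V → Set} where

  Walk-snoc : ∀ {x y z m} → Walk E x y m → E y z → Walk E x z (suc m)
  Walk-snoc stay       e = step e stay
  Walk-snoc (step e w) e′ = step e (Walk-snoc w e′)

  Walk-reverse : (∀ x y → E x y → E y x) → ∀ {x y m} → Walk E x y m → Walk E y x m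
  Walk-reverse sym-E stay                   = stay
  Walk-reverse sym-E (step {x} {y} e w) = Walk-snoc (Walk-reverse sym-E w) (sym-E x y e)

module Harary (h n : ℕ) .{{_ : NonZero h}} .{{_ : NonZero n}} (h+h≤n : h + h ≤ n) where

  Adj : Fin n → Fin n → Set
  Adj = HararyAdj (h * 2) n

  δ : Fin n → Fin n → ℕ
  δ x y = ⌈ circDist n x y / h ⌉

  private
    toℕ≤n : (x : Fin n) → toℕ x ≤ n
    toℕ≤n x = <⇒≤ (toℕ<n x)

    [h*2]/2≡h : h * 2 / 2 ≡ h
    [h*2]/2≡h = m*n/n≡m h 2

  Adj⇒circDist≤h : ∀ {x y} → Adj x y → circDist n x y ≤ h
  Adj⇒circDist≤h (_ , ≤k/2) = subst (_ ≤_) [h*2]/2≡h ≤k/2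

  circDist≡⇒Adj : ∀ {x y e} → circDist n x y ≡ e → 0 < e → e ≤ h → Adj x y
  circDist≡⇒Adj eq 0<e e≤h = subst (1 ≤_) (sym eq) 0<e , subst₂ _≤_ (sym eq) (sym [h*2]/2≡h) e≤h

  Adj-sym : ∀ x y → Adj x y → Adj y x
  Adj-sym x y = subst (λ c → 1 ≤ c × c ≤ h * 2 / 2) (circDistℕ-comm n (toℕ x) (toℕ y))

  δ-comm : ∀ x y → δ x y ≡ δ y x
  δ-comm x y = cong ⌈_/ h ⌉ (circDistℕ-comm n (toℕ x) (toℕ y))

  δ-self : ∀ x → δ x x ≡ 0
  δ-self x = trans (cong ⌈_/ h ⌉ (circDistℕ-self n (toℕ x))) ⌈0/d⌉≡0

  δ-≤-length : ∀ {x y m} → Walk Adj x y m → δ x y ≤ m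
  δ-≤-length {x} stay = ≤-reflexive (δ-self x)
  δ-≤-length {x} {z} (step {y = y} {m = m} x~y w) = begin
    ⌈ circDist n x z / h ⌉                      ≤⟨ ⌈/⌉-monoˡ-≤ (circDistℕ-triangle (toℕ≤n x) (toℕ≤n y) (toℕ≤n z)) ⟩
    ⌈ circDist n x y + circDist n y z / h ⌉     ≤⟨ ⌈/⌉-monoˡ-≤ (+-monoˡ-≤ (circDist n y z) (Adj⇒circDist≤h {x} {y} x~y)) ⟩
    ⌈ h + circDist n y z / h ⌉                  ≡⟨ ⌈d+m/d⌉≡1+⌈m/d⌉ (circDist n y z) ⟩
    suc (δ y z)                                 ≤⟨ s≤s (δ-≤-length w) ⟩
    suc m                                       ∎
    where open ≤-Reasoning

  -- The fuel q bounds the number of steps of length h.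
  walk-forward : ∀ q e (x y : Fin n) → e ≤ h * q → e + e ≤ n → toℕ y ≡ (toℕ x + e) % n →
                 Walk Adj x y ⌈ e / h ⌉
  walk-forward q e x y e≤hq e+e≤n y≡x+e with e ≤? h
  walk-forward q zero x y _ _ y≡x+0 | yes _ = subst₂ (Walk Adj x) x≡y (sym ⌈0/d⌉≡0) stay
    where x≡y : x ≡ y
          x≡y = toℕ-injective (sym (trans y≡x+0 (trans (cong (_% n) (+-identityʳ (toℕ x))) (m<n⇒m%n≡m (toℕ<n x)))))
  walk-forward q (suc e) x y _ e+e≤n y≡x+e | yes e<h =
    subst (Walk Adj x y) (sym (⌈m/d⌉≡1 (s≤s z≤n) e<h))
      (step (circDist≡⇒Adj {x} {y} circDist≡1+e (s≤s z≤n) e<h) stay)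
    where circDist≡1+e : circDist n x y ≡ suc e
          circDist≡1+e = trans (cong (circDistℕ n (toℕ x)) y≡x+e) (circDistℕ-shift (toℕ<n x) e+e≤n)
  walk-forward zero e x y e≤h*0 _ _ | no e≰h = contradiction (≤-trans e≤h*0 (≤-trans (≤-reflexive (*-zeroʳ h)) z≤n)) e≰h
  walk-forward (suc q) e x y e≤h*[1+q] e+e≤n y≡x+e | no e≰h =
    subst (Walk Adj x y) (trans (sym (⌈d+m/d⌉≡1+⌈m/d⌉ e′)) (cong ⌈_/ h ⌉ h+e′≡e))
      (step (circDist≡⇒Adj {x} {z} circDist≡h 0<h ≤-refl) (walk-forward q e′ z y e′≤hq e′+e′≤n y≡z+e′))
    where
      h≤e : h ≤ e
      h≤e = <⇒≤ (≰⇒> e≰h)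
      0<h : 0 < h
      0<h = >-nonZero⁻¹ h
      e′ : ℕ
      e′ = e ∸ h
      h+e′≡e : h + e′ ≡ e
      h+e′≡e = m+[n∸m]≡n h≤e
      z : Fin n
      z = fromℕ< (m%n<n (toℕ x + h) n)
      circDist≡h : circDist n x z ≡ h
      circDist≡h = trans (cong (circDistℕ n (toℕ x)) (toℕ-fromℕ< (m%n<n (toℕ x + h) n))) (circDistℕ-shift (toℕ<n x) h+h≤n)
      e′≤hq : e′ ≤ h * q
      e′≤hq = m≤n+o⇒m∸n≤o e h (subst (e ≤_) (*-suc h q) e≤h*[1+q])
      e′+e′≤n : e′ + e′ ≤ n
      e′+e′≤n = ≤-trans (+-mono-≤ (m∸n≤m e h) (m∸n≤m e h)) e+e≤n
      y≡z+e′ : toℕ y ≡ (toℕ z + e′) % n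
      y≡z+e′ = begin
        toℕ y                          ≡⟨ y≡x+e ⟩
        (toℕ x + e) % n                ≡⟨ cong (λ u → (toℕ x + u) % n) h+e′≡e ⟨
        (toℕ x + (h + e′)) % n         ≡⟨ cong (_% n) (+-assoc (toℕ x) h e′) ⟨
        (toℕ x + h + e′) % n           ≡⟨ [m%n+o]%n≡[m+o]%n (toℕ x + h) e′ n ⟨
        ((toℕ x + h) % n + e′) % n     ≡⟨ cong (λ u → (u + e′) % n) (toℕ-fromℕ< (m%n<n (toℕ x + h) n)) ⟨
        (toℕ z + e′) % n               ∎
        where open ≡-Reasoning

  private
    walk-≤ : ∀ x y → toℕ x ≤ toℕ y → Walk Adj x y (δ x y)
    walk-≤ x y x≤y = by-cases (d ≤? n ∸ d)
      where
        d : ℕ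
        d = toℕ y ∸ toℕ x
        d≤n : d ≤ n
        d≤n = ≤-trans (m∸n≤m (toℕ y) (toℕ x)) (toℕ≤n y)
        circDist≡d⊓[n∸d] : circDist n x y ≡ d ⊓ (n ∸ d)
        circDist≡d⊓[n∸d] = cong (λ u → u ⊓ (n ∸ u)) (m≤n⇒∣m-n∣≡n∸m x≤y)

        by-cases : Dec (d ≤ n ∸ d) → Walk Adj x y (δ x y)
        by-cases (yes d≤n∸d) = subst (Walk Adj x y) (cong ⌈_/ h ⌉ (sym circDist≡d))
            (walk-forward d d x y (m≤n*m d h) (m≤o∸n⇒m+n≤o d d≤n d≤n∸d) y≡x+d)
          where
            circDist≡d : circDist n x y ≡ d
            circDist≡d = trans circDist≡d⊓[n∸d] (m≤n⇒m⊓n≡m d≤n∸d)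
            y≡x+d : toℕ y ≡ (toℕ x + d) % n
            y≡x+d = sym (trans (cong (_% n) (m+[n∸m]≡n x≤y)) (m<n⇒m%n≡m (toℕ<n y)))
        by-cases (no d≰n∸d) = subst (Walk Adj x y) (cong ⌈_/ h ⌉ (sym circDist≡e))
            (Walk-reverse Adj-sym (walk-forward e e y x (m≤n*m e h) e+e≤n x≡y+e))
          where
            e : ℕ
            e = n ∸ d
            e<d : e < d
            e<d = ≰⇒> d≰n∸d
            circDist≡e : circDist n x y ≡ e
            circDist≡e = trans circDist≡d⊓[n∸d] (m≥n⇒m⊓n≡n (<⇒≤ e<d))
            e+e≤n : e + e ≤ n
            e+e≤n = ≤-trans (+-monoʳ-≤ e (<⇒≤ e<d)) (≤-reflexive (m∸n+n≡m d≤n))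
            x≡y+e : toℕ x ≡ (toℕ y + e) % n
            x≡y+e = sym (begin
              (toℕ y + e) % n              ≡⟨ cong (λ u → (u + e) % n) (m+[n∸m]≡n x≤y) ⟨
              (toℕ x + d + e) % n          ≡⟨ cong (_% n) (+-assoc (toℕ x) d e) ⟩
              (toℕ x + (d + e)) % n        ≡⟨ cong (λ u → (toℕ x + u) % n) (m+[n∸m]≡n d≤n) ⟩
              (toℕ x + n) % n              ≡⟨ [m+n]%n≡m%n (toℕ x) n ⟩
              toℕ x % n                    ≡⟨ m<n⇒m%n≡m (toℕ<n x) ⟩
              toℕ x                        ∎)
              where open ≡-Reasoning

  walk : ∀ x y → Walk Adj x y (δ x y)
  walk x y with ≤-total (toℕ x) (toℕ y)
  ... | inj₁ x≤y = walk-≤ x y x≤y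
  ... | inj₂ y≤x = subst (Walk Adj x y) (δ-comm y x) (Walk-reverse Adj-sym (walk-≤ y x y≤x))

  δ-isDistance : IsDistance Adj δ
  δ-isDistance x y = walk x y , λ _ → δ-≤-length

  vertexStatus : ℕ
  vertexStatus = ∑[ t < suc ⌊ n /2⌋ ] ⌈ t / h ⌉ + ∑[ t < suc ⌊ pred n /2⌋ ] ⌈ t / h ⌉

  status-δ : ∀ x → status δ x ≡ vertexStatus
  status-δ x = begin
    status δ x                                  ≡⟨ sum-map-allFin n (λ b → ⌈ circDistℕ n (toℕ x) b / h ⌉) ⟩
    ∑[ b < n ] ⌈ circDistℕ n (toℕ x) b / h ⌉    ≡⟨ ∑-circDistℕ-centre-invariant n ⌈_/ h ⌉ (toℕ<n x) ⟩
    ∑[ b < n ] ⌈ circDistℕ n 0 b / h ⌉          ≡⟨ subst (λ N → ∑[ b < N ] ⌈ circDistℕ N 0 b / h ⌉ ≡ vertexStatus) (1+⌊n/2⌋+⌊pred[n]/2⌋≡n n)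
                                                     (∑-circDistℕ-halves ⌈_/ h ⌉ ⌈0/d⌉≡0 (⌊n/2⌋-mono pred[n]≤n) (⌊n/2⌋≤1+⌊pred[n]/2⌋ n)) ⟩
    vertexStatus                                ∎
    where open ≡-Reasoning

  4*wiener-δ : 4 * wiener δ ≡ n * (2 * vertexStatus)
  4*wiener-δ = begin
    4 * wiener δ                                ≡⟨ lemma (wiener δ) ⟩
    2 * (2 * wiener δ)                          ≡⟨ cong (2 *_) (2*wiener≡∑status n δ δ-comm δ-self) ⟩
    2 * sum (map (status δ) (allFin n))         ≡⟨ cong (λ xs → 2 * sum xs) (map-cong status-δ (allFin n)) ⟩
    2 * sum (map (λ _ → vertexStatus) (allFin n)) ≡⟨ cong (2 *_) (sum-map-allFin n (λ _ → vertexStatus)) ⟩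
    2 * ∑[ _ < n ] vertexStatus                 ≡⟨ cong (2 *_) (∑-const n vertexStatus) ⟩
    2 * (n * vertexStatus)                      ≡⟨ lemma₂ n vertexStatus ⟩
    n * (2 * vertexStatus)                      ∎
    where
      open ≡-Reasoning
      lemma : ∀ w → 4 * w ≡ 2 * (2 * w)
      lemma = solve-∀
      lemma₂ : ∀ n s → 2 * (n * s) ≡ n * (2 * s)
      lemma₂ = solve-∀

  δ-isDiameter : IsDiameter δ ⌈ ⌊ n /2⌋ / h ⌉
  δ-isDiameter = (λ x y → ⌈/⌉-monoˡ-≤ (m+m≤n⇒m≤⌊n/2⌋ (circDistℕ-half (toℕ≤n x) (toℕ≤n y))))
               , origin , antipode , cong ⌈_/ h ⌉ circDist≡⌊n/2⌋
    where
      a : ℕ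
      a = ⌊ n /2⌋
      a<n : a < n
      a<n = subst (a <_) (1+⌊n/2⌋+⌊pred[n]/2⌋≡n n) (s≤s (m≤m+n a ⌊ pred n /2⌋))
      a+a≤n : a + a ≤ n
      a+a≤n = subst (a + a ≤_) (⌊n/2⌋+⌈n/2⌉≡n n) (+-monoʳ-≤ a (⌊n/2⌋≤⌈n/2⌉ n))
      origin antipode : Fin n
      origin   = fromℕ< (>-nonZero⁻¹ n)
      antipode = fromℕ< a<n
      circDist≡⌊n/2⌋ : circDist n origin antipode ≡ a
      circDist≡⌊n/2⌋ = trans (cong₂ (circDistℕ n) (toℕ-fromℕ< (>-nonZero⁻¹ n)) (toℕ-fromℕ< a<n))
                             (m≤n⇒m⊓n≡m (m+n≤o⇒m≤o∸n a a+a≤n))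

2*n+k∸2∸k*D≡n+r : ∀ {n k D r} → 2 ≤ k → n + k ∸ 2 ≡ r + D * k → 2 * n + k ∸ 2 ∸ k * D ≡ n + r
2*n+k∸2∸k*D≡n+r {n} {k} {D} {r} 2≤k eq = begin
  2 * n + k ∸ 2 ∸ k * D       ≡⟨ cong (λ x → x + k ∸ 2 ∸ k * D) (lemma₁ n) ⟩
  n + n + k ∸ 2 ∸ k * D       ≡⟨ cong (λ x → x ∸ 2 ∸ k * D) (+-assoc n n k) ⟩
  n + (n + k) ∸ 2 ∸ k * D     ≡⟨ cong (_∸ k * D) (+-∸-assoc n (≤-trans 2≤k (m≤n+m k n))) ⟩
  n + (n + k ∸ 2) ∸ k * D     ≡⟨ cong (λ x → n + x ∸ k * D) eq ⟩
  n + (r + D * k) ∸ k * D     ≡⟨ cong (_∸ k * D) (lemma₂ n r D k) ⟩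
  n + r + k * D ∸ k * D       ≡⟨ m+n∸n≡m (n + r) (k * D) ⟩
  n + r                       ∎
  where
    open ≡-Reasoning
    lemma₁ : ∀ n → 2 * n ≡ n + n
    lemma₁ = solve-∀
    lemma₂ : ∀ n r D k → n + (r + D * k) ≡ n + r + k * D
    lemma₂ = solve-∀

n+k∸2-quotient : ∀ m k .{{_ : NonZero k}} → 2 ≤ k → k ≤ suc m →
                 Σ ℕ λ q → (suc m + k ∸ 2) / k ≡ suc q × m ≡ suc ((suc m + k ∸ 2) % k + q * k)
n+k∸2-quotient m k 2≤k k≤1+m = q , D≡1+q , +-cancelʳ-≡ k m (suc (r + q * k)) (suc-injective (begin
  suc m + k                     ≡⟨ m∸n+n≡m (≤-trans 2≤k (m≤n+m k (suc m))) ⟨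
  N + 2                         ≡⟨ cong (_+ 2) (m≡m%n+[m/n]*n N k) ⟩
  r + D * k + 2                 ≡⟨ cong (λ d → r + d * k + 2) D≡1+q ⟩
  r + suc q * k + 2             ≡⟨ lemma r q k ⟩
  suc (suc (r + q * k) + k)     ∎))
  where
    open ≡-Reasoning
    N D r q : ℕ
    N = suc m + k ∸ 2
    D = N / k
    r = N % k
    q = (N ∸ k) / k
    D≡1+q : D ≡ suc q
    D≡1+q = m/n≡1+[m∸n]/n (m+n≤o⇒m≤o∸n k (≤-trans (≤-reflexive (+-comm k 2)) (+-monoˡ-≤ k (≤-trans 2≤k k≤1+m))))
    lemma : ∀ r q k → r + suc q * k + 2 ≡ suc (suc (r + q * k) + k)
    lemma = solve-∀

lemma3p1 : (n k : ℕ) → .{{_ : NonZero k}} → 2 ≤ k → k < n ∸ 1 → 2 ∣ k →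
    Σ (Fin n → Fin n → ℕ) (λ δ →
      IsDistance (HararyAdj k n) δ
      × IsDiameter δ ((n + k ∸ 2) / k)
      × (∀ x → 2 * status δ x ≡ ((n + k ∸ 2) / k) * (2 * n + k ∸ 2 ∸ k * ((n + k ∸ 2) / k)))
      × 4 * wiener δ ≡ n * ((n + k ∸ 2) / k) * (2 * n + k ∸ 2 ∸ k * ((n + k ∸ 2) / k)))
lemma3p1 n       .(0 * 2)       ()  _   (divides zero refl)
lemma3p1 zero    .(suc h′ * 2) _   ()  (divides (suc h′) refl)
lemma3p1 (suc m) .(suc h′ * 2) 2≤k k<m (divides (suc h′) refl) =
  δ , δ-isDistance , subst (IsDiameter δ) diameter≡D δ-isDiameter ,
  (λ x → trans (cong (2 *_) (status-δ x)) 2*vertexStatus≡) ,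
  trans 4*wiener-δ (trans (cong (n *_) 2*vertexStatus≡) (sym (*-assoc n D _)))
  where
    h k n D r : ℕ
    h = suc h′
    k = h * 2
    n = suc m
    D = (n + k ∸ 2) / k
    r = (n + k ∸ 2) % k
    k≤n : k ≤ n
    k≤n = ≤-trans (n≤1+n k) (≤-trans k<m (n≤1+n m))
    h+h≡k : h + h ≡ k
    h+h≡k = trans (cong (h +_) (sym (+-identityʳ h))) (*-comm 2 h)
    open Harary h n (≤-trans (≤-reflexive h+h≡k) k≤n)
    quotient : Σ ℕ λ q → D ≡ suc q × m ≡ suc (r + q * k)
    quotient = n+k∸2-quotient m k 2≤k k≤n
    q : ℕ
    q = proj₁ quotient
    D≡1+q : D ≡ suc q
    D≡1+q = proj₁ (proj₂ quotient)
    m≡1+r+qk : m ≡ suc (r + q * k)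
    m≡1+r+qk = proj₂ (proj₂ quotient)
    diameter≡D : ⌈ ⌊ n /2⌋ / h ⌉ ≡ D
    diameter≡D = trans (⌈⌈m/2⌉/h⌉≡1+q {h} {q} {r} {m} (m%n<n (n + k ∸ 2) k) m≡1+r+qk) (sym D≡1+q)
    2*vertexStatus≡ : 2 * vertexStatus ≡ D * (2 * n + k ∸ 2 ∸ k * D)
    2*vertexStatus≡ = trans (2*∑⌈s/h⌉-halves≡[1+q]*[1+m+r] {h} {q} {r} {m} (m%n<n (n + k ∸ 2) k) m≡1+r+qk)
                            (sym (cong₂ _*_ D≡1+q (2*n+k∸2∸k*D≡n+r {n} {k} {D} {r} 2≤k (m≡m%n+[m/n]*n (n + k ∸ 2) k))))
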